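{- There exist absolute constants $\gamma_0 > 0$ and $c_0 > 0$ such that the following holds. Let $n \ge 2$ and $0 \le k \le n/2$ be integers, $p = k/n$, and let $x$ be uniformly random in $\binom{[n]}{k}$. Let $t \le n/2$ be a nonnegative integer and $X = \sum_{i=1}^t x_i$. If $\Pr[X \in \{m, m+1\}] \ge 1 - \gamma_0$ for some $m$, then $\Pr[X = 0] \ge c_0$ and $t \le \frac{3}{2}p^{ -1}$.
   Context: $\binom{[n]}{k} = \{x \in \{0,1\}^n : \sum_i x_i = k\}$. When $k=0$ the bound $t \le \frac32 p^{ -1}$ is read as vacuous. -}

module Defs where

open import Data.Bool using (Bool; true; false; if_then_else_)
open import Data.Nat using (ℕ; zero; suc; _+_; _≡ᵇ_)
open import Data.List using (List; []; _∷_; _++_; map; length; filterᵇ)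
open import Data.Vec using (Vec; []; _∷_)
open import Data.Integer using (+_)
open import Data.Rational using (ℚ; _/_; 0ℚ)

allVecs : (n : ℕ) → List (Vec Bool n)
allVecs zero = [] ∷ []
allVecs (suc n) = map (true ∷_) (allVecs n) ++ map (false ∷_) (allVecs n)

bit : Bool → ℕ
bit b = if b then 1 else 0

weight : {n : ℕ} → Vec Bool n → ℕ
weight [] = 0
weight (b ∷ v) = bit b + weight v

-- the slice binom([n],k) = { x ∈ {0,1}^n : Σ x_i = k }, as a list without repetition
slice : (n k : ℕ) → List (Vec Bool n)
slice n k = filterᵇ (λ v → weight v ≡ᵇ k) (allVecs n)

prefixSum : {n : ℕ} → ℕ → Vec Bool n → ℕ
prefixSum zero v = 0
prefixSum (suc t) [] = 0
prefixSum (suc t) (b ∷ v) = bit b + prefixSum t v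

-- a / b as a rational (b = 0 never occurs for a nonempty slice; then 0)
ratio : ℕ → ℕ → ℚ
ratio a zero = 0ℚ
ratio a (suc b) = (+ a) / suc b

Pr : (n k : ℕ) → (Vec Bool n → Bool) → ℚ
Pr n k E = ratio (length (filterᵇ E (slice n k))) (length (slice n k))

module Submission where

-- Let A j be the number of x in the slice with x₁ + ⋯ + x_t = j, the hypergeometric count
-- C(t,j)·C(n−t,k−j). With D = n − t − k,
--   (j+1)(j+1+D) · A(j+1) = (t−j)(k−j) · A j,
-- so A is nonincreasing from j = min(t,k) − 1 on, and the ratios A(j+1)/A j and A(j+2)/A(j+1)
-- differ by four factors of the form (x+2)/(x+1) ≤ 2, whence A(j+1)² ≤ 16 · A j · A(j+2).
-- If A m + A(m+1) is at least 99% of the slice, every other A j is at most 1% of it, so the pair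
-- cannot be bounded by 32 times a neighbour. This excludes an ascent A m ≤ A(m+1) followed by a
-- value A(m+2), and a descent A(m+1) ≤ A m preceded by a value A(m−1); hence m = 0 and A 1 ≤ A 0,
-- which gives Pr[X = 0] ≥ 1/3. Finally A 0 ≤ A 1 as soon as tk > D, which 2tk > 3n would force.

open import Defs
open import Data.Bool using (Bool; true; false; _∧_; _∨_)
open import Data.Bool.Properties using (∧-zeroʳ; ∧-identityʳ; ∧-distribˡ-∨)
import Data.Integer as ℤ
open import Data.Integer.Properties using (pos-*)
open import Data.List using (List; []; _∷_; _++_; map; length; filterᵇ)
open import Data.List.Properties using (length-++; filter-++; length-filter)
open import Data.Nat hiding (_<_; _/_)
open import Data.Nat.Combinatorics using (_C_; nC1≡n; nCk+nC[k+1]≡[n+1]C[k+1])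
open import Data.Nat.Properties
open import Data.Nat.Tactic.RingSolver using (solve-∀)
open import Data.Product using (_×_; _,_; proj₁; proj₂; ∃-syntax)
open import Data.Rational using (ℚ; 0ℚ; 1ℚ; _-_; _<_; _/_; *<*) renaming (_≤_ to _≤ℚ_)
open import Data.Rational.Properties using (toℚᵘ-mono-≤; toℚᵘ-cancel-≤; toℚᵘ-fromℚᵘ)
open import Data.Rational.Unnormalised using (mkℚᵘ; *≤*)
open import Data.Rational.Unnormalised.Properties using (≤-respˡ-≃; ≤-respʳ-≃; ≃-sym)
open import Data.Sum using (_⊎_; inj₁; inj₂)
open import Data.Vec using (Vec; []; _∷_)
open import Function using (_∘_; const)
open import Relation.Nullary using (¬_; Dec; yes; no; does)
open import Relation.Nullary.Decidable using (T?; dec-false; from-no; decidable-stable)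
open import Relation.Binary.PropositionalEquality

count : {A : Set} → (A → Bool) → List A → ℕ
count p xs = length (filterᵇ p xs)

module _ {A : Set} where

  count-cong : {p q : A → Bool} → (∀ x → p x ≡ q x) → ∀ xs → count p xs ≡ count q xs
  count-cong p≗q [] = refl
  count-cong {q = q} p≗q (x ∷ xs) rewrite p≗q x with q x
  ... | true  = cong suc (count-cong p≗q xs)
  ... | false = count-cong p≗q xs

  count-none : {p : A → Bool} → (∀ x → p x ≡ false) → ∀ xs → count p xs ≡ 0
  count-none p≡false []       = refl
  count-none p≡false (x ∷ xs) rewrite p≡false x = count-none p≡false xs

  count≤length : (p : A → Bool) → ∀ xs → count p xs ≤ length xs
  count≤length p = length-filter (T? ∘ p)

  count-++ : (p : A → Bool) → ∀ xs ys → count p (xs ++ ys) ≡ count p xs + count p ys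
  count-++ p xs ys = trans (cong length (filter-++ (T? ∘ p) xs ys)) (length-++ (filterᵇ p xs))

  count-map : {B : Set} (p : B → Bool) (f : A → B) → ∀ xs → count p (map f xs) ≡ count (p ∘ f) xs
  count-map p f [] = refl
  count-map p f (x ∷ xs) with p (f x)
  ... | true  = cong suc (count-map p f xs)
  ... | false = count-map p f xs

  count-filterᵇ : (p q : A → Bool) → ∀ xs → count q (filterᵇ p xs) ≡ count (λ x → p x ∧ q x) xs
  count-filterᵇ p q [] = refl
  count-filterᵇ p q (x ∷ xs) with p x
  ... | false = count-filterᵇ p q xs
  ... | true with q x
  ...   | true  = cong suc (count-filterᵇ p q xs)
  ...   | false = count-filterᵇ p q xs

  count-∨ : (p q : A → Bool) → (∀ x → p x ∧ q x ≡ false) → ∀ xs →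
            count (λ x → p x ∨ q x) xs ≡ count p xs + count q xs
  count-∨ p q disjoint [] = refl
  count-∨ p q disjoint (x ∷ xs) with p x | q x | disjoint x
  ... | true  | false | _ = cong suc (count-∨ p q disjoint xs)
  ... | false | true  | _ = trans (cong suc (count-∨ p q disjoint xs)) (sym (+-suc _ _))
  ... | false | false | _ = count-∨ p q disjoint xs

≡ᵇ-disjoint : ∀ a {m n} → m ≢ n → (a ≡ᵇ m) ∧ (a ≡ᵇ n) ≡ false
≡ᵇ-disjoint a {m} {n} m≢n = decided (a ≟ m)
  where
  decided : (a≟m : Dec (a ≡ m)) → does a≟m ∧ (a ≡ᵇ n) ≡ false
  decided (no _)     = refl
  decided (yes refl) = dec-false (a ≟ n) m≢n

nCk>0 : ∀ {n k} → k ≤ n → 1 ≤ n C k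
nCk>0 {k = zero}  _         = s≤s z≤n
nCk>0 {suc n} {suc k} (s≤s k≤n) =
  subst (1 ≤_) (nCk+nC[k+1]≡[n+1]C[k+1] n k) (≤-trans (nCk>0 k≤n) (m≤m+n _ _))

[k+1]*nC[k+1]+k*nCk≡n*nCk : ∀ n k → suc k * (n C suc k) + k * (n C k) ≡ n * (n C k)
[k+1]*nC[k+1]+k*nCk≡n*nCk n       zero    = trans (cong (λ x → 1 * x + 0) (nC1≡n n)) (unit n)
  where unit : ∀ n → 1 * n + 0 ≡ n * 1
        unit = solve-∀
[k+1]*nC[k+1]+k*nCk≡n*nCk zero    (suc k) = cong₂ _+_ (*-zeroʳ (suc (suc k))) (*-zeroʳ (suc k))
[k+1]*nC[k+1]+k*nCk≡n*nCk (suc n) (suc k) = begin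
  suc (suc k) * (suc n C suc (suc k)) + suc k * (suc n C suc k)
    ≡⟨ cong₂ (λ x y → suc (suc k) * x + suc k * y) (sym pascal₁) (sym pascal₀) ⟩
  suc (suc k) * (b + c) + suc k * (a + b)
    ≡⟨ regroup k a b c ⟩
  (suc (suc k) * c + suc k * b) + (suc k * b + k * a) + (a + b)
    ≡⟨ cong₂ (λ x y → x + y + (a + b)) ([k+1]*nC[k+1]+k*nCk≡n*nCk n (suc k))
                                       ([k+1]*nC[k+1]+k*nCk≡n*nCk n k) ⟩
  n * b + n * a + (a + b)
    ≡⟨ collect n a b ⟩
  suc n * (a + b)
    ≡⟨ cong (suc n *_) pascal₀ ⟩
  suc n * (suc n C suc k) ∎
  where
  open ≡-Reasoning
  a = n C k
  b = n C suc k
  c = n C suc (suc k)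
  pascal₀ : a + b ≡ suc n C suc k
  pascal₀ = nCk+nC[k+1]≡[n+1]C[k+1] n k
  pascal₁ : b + c ≡ suc n C suc (suc k)
  pascal₁ = nCk+nC[k+1]≡[n+1]C[k+1] n (suc k)
  regroup : ∀ k a b c → suc (suc k) * (b + c) + suc k * (a + b) ≡
            (suc (suc k) * c + suc k * b) + (suc k * b + k * a) + (a + b)
  regroup = solve-∀
  collect : ∀ n a b → n * b + n * a + (a + b) ≡ suc n * (a + b)
  collect = solve-∀

[k+1]*nC[k+1]≡[n∸k]*nCk : ∀ n k → suc k * (n C suc k) ≡ (n ∸ k) * (n C k)
[k+1]*nC[k+1]≡[n∸k]*nCk n k = begin
  suc k * (n C suc k)                             ≡⟨ m+n∸n≡m _ (k * (n C k)) ⟨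
  suc k * (n C suc k) + k * (n C k) ∸ k * (n C k) ≡⟨ cong (_∸ k * (n C k)) ([k+1]*nC[k+1]+k*nCk≡n*nCk n k) ⟩
  n * (n C k) ∸ k * (n C k)                       ≡⟨ *-distribʳ-∸ (n C k) n k ⟨
  (n ∸ k) * (n C k)                               ∎
  where open ≡-Reasoning

count-allVecs-suc : ∀ n (p : Vec Bool (suc n) → Bool) → count p (allVecs (suc n)) ≡
                    count (p ∘ (true ∷_)) (allVecs n) + count (p ∘ (false ∷_)) (allVecs n)
count-allVecs-suc n p = trans (count-++ p (map (true ∷_) (allVecs n)) (map (false ∷_) (allVecs n)))
  (cong₂ _+_ (count-map p (true ∷_) (allVecs n)) (count-map p (false ∷_) (allVecs n)))

length-slice : ∀ n k → length (slice n k) ≡ n C k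
length-slice zero    zero    = refl
length-slice zero    (suc k) = refl
length-slice (suc n) zero    = trans (count-allVecs-suc n _)
  (cong₂ _+_ (count-none (λ _ → refl) (allVecs n)) (length-slice n zero))
length-slice (suc n) (suc k) = trans (count-allVecs-suc n _)
  (trans (cong₂ _+_ (length-slice n k) (length-slice n (suc k))) (nCk+nC[k+1]≡[n+1]C[k+1] n k))

prefixSum≤weight : ∀ {n} t (v : Vec Bool n) → prefixSum t v ≤ weight v
prefixSum≤weight zero    v       = z≤n
prefixSum≤weight (suc t) []      = z≤n
prefixSum≤weight (suc t) (b ∷ v) = +-monoʳ-≤ (bit b) (prefixSum≤weight t v)

prefixCount : (n k t j : ℕ) → ℕ
prefixCount n k t j = count (λ x → prefixSum t x ≡ᵇ j) (slice n k)

prefixCount≡count-allVecs : ∀ n k t j →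
  prefixCount n k t j ≡ count (λ v → (weight v ≡ᵇ k) ∧ (prefixSum t v ≡ᵇ j)) (allVecs n)
prefixCount≡count-allVecs n k t j =
  count-filterᵇ (λ v → weight v ≡ᵇ k) (λ v → prefixSum t v ≡ᵇ j) (allVecs n)

prefixCount-product : ∀ t r j b → prefixCount (t + r) (j + b) t j ≡ (t C j) * (r C b)
prefixCount-product t r j b = trans (prefixCount≡count-allVecs (t + r) (j + b) t j) (product t j)
  where
  product : ∀ t j →
    count (λ v → (weight v ≡ᵇ j + b) ∧ (prefixSum t v ≡ᵇ j)) (allVecs (t + r)) ≡ (t C j) * (r C b)
  product zero    zero    = trans (count-cong (λ v → ∧-identityʳ _) (allVecs r))
                                  (trans (length-slice r b) (sym (+-identityʳ _)))
  product zero    (suc j) = count-none (λ v → ∧-zeroʳ _) (allVecs r)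
  product (suc t) zero    = trans (count-allVecs-suc (t + r) _)
    (cong₂ _+_ (count-none (λ v → ∧-zeroʳ _) (allVecs (t + r))) (product t zero))
  product (suc t) (suc j) = trans (count-allVecs-suc (t + r) _)
    (trans (cong₂ _+_ (product t j) (product t (suc j)))
      (trans (sym (*-distribʳ-+ (r C b) (t C j) (t C suc j)))
        (cong (_* (r C b)) (nCk+nC[k+1]≡[n+1]C[k+1] t j))))

prefixCount-vanish : ∀ n k t j → j > k → prefixCount n k t j ≡ 0
prefixCount-vanish n k t j j>k =
  trans (prefixCount≡count-allVecs n k t j) (count-none impossible (allVecs n))
  where
  impossible : ∀ v → (weight v ≡ᵇ k) ∧ (prefixSum t v ≡ᵇ j) ≡ false
  impossible v = decided (weight v ≟ k)
    where
    decided : (w≟k : Dec (weight v ≡ k)) → does w≟k ∧ (prefixSum t v ≡ᵇ j) ≡ false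
    decided (no _)    = refl
    decided (yes w≡k) = dec-false (prefixSum t v ≟ j)
      (λ p≡j → <⇒≱ j>k (subst₂ _≤_ p≡j w≡k (prefixSum≤weight t v)))

-- For k = j + 1 + b this is the absorption identity applied to both binomials of
-- A(j+1) = C(t,j+1)·C(k+D,b).
prefixCount-recurrence : ∀ t k D j →
  prefixCount (t + (k + D)) k t (suc j) * (suc j * suc (j + D)) ≡
  prefixCount (t + (k + D)) k t j * ((t ∸ j) * (k ∸ j))
prefixCount-recurrence t k D j with suc j ≤? k
... | no j+1≰k = begin
  A (suc j) * (suc j * suc (j + D)) ≡⟨ cong (_* _) (prefixCount-vanish n k t (suc j) (≰⇒> j+1≰k)) ⟩
  0                                 ≡⟨ *-zeroʳ (A j) ⟨
  A j * 0                           ≡⟨ cong (A j *_) (*-zeroʳ (t ∸ j)) ⟨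
  A j * ((t ∸ j) * 0)               ≡⟨ cong (λ x → A j * ((t ∸ j) * x)) k∸j≡0 ⟨
  A j * ((t ∸ j) * (k ∸ j))         ∎
  where
  open ≡-Reasoning
  n = t + (k + D)
  A : ℕ → ℕ
  A = prefixCount n k t
  k∸j≡0 : k ∸ j ≡ 0
  k∸j≡0 = m≤n⇒m∸n≡0 (≤-pred (≰⇒> j+1≰k))
... | yes j+1≤k with b , refl ← m≤n⇒∃[o]m+o≡n j+1≤k = begin
  prefixCount (t + r) k t (suc j) * (suc j * suc (j + D))
    ≡⟨ cong₂ (λ x y → x * (suc j * y)) (prefixCount-product t r (suc j) b) j+1+D≡r∸b ⟩
  (t C suc j) * (r C b) * (suc j * (r ∸ b))
    ≡⟨ regroup (t C suc j) (r C b) (suc j) (r ∸ b) ⟩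
  (suc j * (t C suc j)) * ((r ∸ b) * (r C b))
    ≡⟨ cong₂ _*_ ([k+1]*nC[k+1]≡[n∸k]*nCk t j) (sym ([k+1]*nC[k+1]≡[n∸k]*nCk r b)) ⟩
  ((t ∸ j) * (t C j)) * (suc b * (r C suc b))
    ≡⟨ regroup (t C j) (r C suc b) (t ∸ j) (suc b) ⟨
  (t C j) * (r C suc b) * ((t ∸ j) * suc b)
    ≡⟨ cong₂ (λ x y → x * ((t ∸ j) * y)) product k∸j≡1+b ⟨
  prefixCount (t + r) k t j * ((t ∸ j) * (k ∸ j)) ∎
  where
  open ≡-Reasoning
  r = k + D
  regroup : ∀ a b c d → a * b * (c * d) ≡ (c * a) * (d * b)
  regroup = solve-∀
  j+1+D≡r∸b : suc (j + D) ≡ r ∸ b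
  j+1+D≡r∸b = sym (trans (cong (_∸ b) (shuffle j b D)) (m+n∸m≡n b (suc (j + D))))
    where shuffle : ∀ j b D → suc j + b + D ≡ b + suc (j + D)
          shuffle = solve-∀
  k∸j≡1+b : k ∸ j ≡ suc b
  k∸j≡1+b = trans (cong (_∸ j) (sym (+-suc j b))) (m+n∸m≡n j (suc b))
  product : prefixCount (t + r) k t j ≡ (t C j) * (r C suc b)
  product = subst (λ κ → prefixCount (t + r) κ t j ≡ (t C j) * (r C suc b)) (+-suc j b)
                  (prefixCount-product t r j (suc b))

2+n≤2*[1+n] : ∀ n → suc (suc n) ≤ 2 * suc n
2+n≤2*[1+n] n = s≤s (subst (suc n ≤_) (sym (+-suc n (n + 0))) (s≤s (m≤m+n n (n + 0))))

b*b≤16*[a*c] : ∀ a b c u e x y →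
  b * (suc u * suc e) ≡ a * (suc (suc x) * suc (suc y)) →
  c * (suc (suc u) * suc (suc e)) ≡ b * (suc x * suc y) →
  b * b ≤ 16 * (a * c)
b*b≤16*[a*c] a b c u e x y b-step c-step =
  *-cancelʳ-≤ (b * b) (16 * (a * c)) (suc u * suc e * (suc x * suc y)) (begin
    b * b * (suc u * suc e * (suc x * suc y))     ≡⟨ regroup b (suc u * suc e) (suc x * suc y) ⟩
    (b * (suc u * suc e)) * (b * (suc x * suc y)) ≡⟨ cong₂ _*_ b-step (sym c-step) ⟩
    (a * (suc (suc x) * suc (suc y))) * (c * (suc (suc u) * suc (suc e)))
      ≤⟨ *-mono-≤ (*-monoʳ-≤ a (*-mono-≤ (2+n≤2*[1+n] x) (2+n≤2*[1+n] y)))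
                  (*-monoʳ-≤ c (*-mono-≤ (2+n≤2*[1+n] u) (2+n≤2*[1+n] e))) ⟩
    (a * (2 * suc x * (2 * suc y))) * (c * (2 * suc u * (2 * suc e)))
      ≡⟨ collect a c (suc u) (suc e) (suc x) (suc y) ⟩
    16 * (a * c) * (suc u * suc e * (suc x * suc y)) ∎)
  where
  open ≤-Reasoning
  regroup : ∀ b p q → b * b * (p * q) ≡ (b * p) * (b * q)
  regroup = solve-∀
  collect : ∀ a c u e x y →
    (a * (2 * x * (2 * y))) * (c * (2 * u * (2 * e))) ≡ 16 * (a * c) * (u * e * (x * y))
  collect = solve-∀

u*u≤16*[a*v]⇒u≤16*a : ∀ {u v} a → v ≤ u → u * u ≤ 16 * (a * v) → u ≤ 16 * a
u*u≤16*[a*v]⇒u≤16*a {zero}      a _   _   = z≤n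
u*u≤16*[a*v]⇒u≤16*a {u@(suc _)} {v} a v≤u u²≤ = *-cancelʳ-≤ u (16 * a) u (begin
  u * u        ≤⟨ u²≤ ⟩
  16 * (a * v) ≤⟨ *-monoʳ-≤ 16 (*-monoʳ-≤ a v≤u) ⟩
  16 * (a * u) ≡⟨ *-assoc 16 a u ⟨
  16 * a * u   ∎)
  where open ≤-Reasoning

v≤u≤16*a⇒u+v≤32*a : ∀ {u v} a → v ≤ u → u ≤ 16 * a → u + v ≤ 32 * a
v≤u≤16*a⇒u+v≤32*a {u} {v} a v≤u u≤16a = begin
  u + v           ≤⟨ +-monoʳ-≤ u v≤u ⟩
  u + u           ≤⟨ +-mono-≤ u≤16a u≤16a ⟩
  16 * a + 16 * a ≡⟨ *-distribʳ-+ a 16 16 ⟨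
  32 * a          ∎
  where open ≤-Reasoning

a≤1⇒2*a*b≤3*n : ∀ {a b n} → a ≤ 1 → b ≤ n → 2 * a * b ≤ 3 * n
a≤1⇒2*a*b≤3*n {a} {b} a≤1 b≤n =
  ≤-trans (*-monoˡ-≤ b (≤-trans (*-monoʳ-≤ 2 a≤1) (n≤1+n 2))) (*-monoʳ-≤ 3 b≤n)

2tk≰3n⇒D<tk : ∀ t k D → ¬ (2 * t * k ≤ 3 * (t + (k + D))) → suc D ≤ t * k
2tk≰3n⇒D<tk t k D 2tk≰3n = ≤-trans (s≤s D≤n) n<tk
  where
  n = t + (k + D)
  D≤n : D ≤ n
  D≤n = ≤-trans (m≤n+m D k) (m≤n+m (k + D) t)
  n<tk : suc n ≤ t * k
  n<tk = *-cancelˡ-< 2 n (t * k) (begin-strict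
    2 * n       ≤⟨ *-monoˡ-≤ n (n≤1+n 2) ⟩
    3 * n       <⟨ ≰⇒> 2tk≰3n ⟩
    2 * t * k   ≡⟨ *-assoc 2 t k ⟩
    2 * (t * k) ∎)
    where open ≤-Reasoning

<-both⊎≤-either : ∀ a b c → (suc a ≤ b × suc a ≤ c) ⊎ (b ≤ a ⊎ c ≤ a)
<-both⊎≤-either a b c with suc a ≤? b | suc a ≤? c
... | yes a<b | yes a<c = inj₁ (a<b , a<c)
... | no a≮b  | _       = inj₂ (inj₁ (≤-pred (≰⇒> a≮b)))
... | yes _   | no a≮c  = inj₂ (inj₂ (≤-pred (≰⇒> a≮c)))

module HypergeometricRecurrence (A : ℕ → ℕ) {t k D : ℕ} (t≤k+D : t ≤ k + D) (k≤t+D : k ≤ t + D)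
  (recurrence : ∀ j → A (suc j) * (suc j * suc (j + D)) ≡ A j * ((t ∸ j) * (k ∸ j))) where

  private
    factors≤ : ∀ j {a b} → a ≤ suc j → b ≤ a + D → (a ∸ j) * (b ∸ j) ≤ suc j * suc (j + D)
    factors≤ j {a} {b} a≤1+j b≤a+D = begin
      (a ∸ j) * (b ∸ j)   ≤⟨ *-monoˡ-≤ (b ∸ j) (m≤n+o⇒m∸n≤o a j (subst (a ≤_) (+-comm 1 j) a≤1+j)) ⟩
      1 * (b ∸ j)         ≡⟨ *-identityˡ (b ∸ j) ⟩
      b ∸ j               ≤⟨ m∸n≤m b j ⟩
      b                   ≤⟨ b≤a+D ⟩
      a + D               ≤⟨ +-monoˡ-≤ D a≤1+j ⟩
      suc (j + D)         ≤⟨ m≤n*m (suc (j + D)) (suc j) ⟩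
      suc j * suc (j + D) ∎
      where open ≤-Reasoning

  A-nonincreasing : ∀ j → t ≤ suc j ⊎ k ≤ suc j → A (suc j) ≤ A j
  A-nonincreasing j past = *-cancelʳ-≤ (A (suc j)) (A j) (suc j * suc (j + D)) (begin
    A (suc j) * (suc j * suc (j + D)) ≡⟨ recurrence j ⟩
    A j * ((t ∸ j) * (k ∸ j))         ≤⟨ *-monoʳ-≤ (A j) (factors past) ⟩
    A j * (suc j * suc (j + D))       ∎)
    where
    open ≤-Reasoning
    factors : t ≤ suc j ⊎ k ≤ suc j → (t ∸ j) * (k ∸ j) ≤ suc j * suc (j + D)
    factors (inj₁ t≤1+j) = factors≤ j t≤1+j k≤t+D
    factors (inj₂ k≤1+j) = subst (_≤ suc j * suc (j + D)) (*-comm (k ∸ j) (t ∸ j)) (factors≤ j k≤1+j t≤k+D)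

  A-square≤16*neighbours : ∀ j → suc (suc j) ≤ t → suc (suc j) ≤ k →
                           A (suc j) * A (suc j) ≤ 16 * (A j * A (suc (suc j)))
  A-square≤16*neighbours j 2+j≤t 2+j≤k =
    b*b≤16*[a*c] (A j) (A (suc j)) (A (suc (suc j))) j (j + D) (t ∸ suc (suc j)) (k ∸ suc (suc j))
      (trans (recurrence j) (cong (A j *_) (cong₂ _*_ (+-∸-assoc 2 2+j≤t) (+-∸-assoc 2 2+j≤k))))
      (trans (recurrence (suc j)) (cong (A (suc j) *_) (cong₂ _*_ (+-∸-assoc 1 2+j≤t) (+-∸-assoc 1 2+j≤k))))

  A0≤A1 : suc D ≤ t * k → A 0 ≤ A 1
  A0≤A1 D<tk = *-cancelʳ-≤ (A 0) (A 1) (t * k) {{>-nonZero (≤-trans (s≤s z≤n) D<tk)}} (begin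
    A 0 * (t * k)     ≡⟨ recurrence 0 ⟨
    A 1 * (1 * suc D) ≤⟨ *-monoʳ-≤ (A 1) (subst (_≤ t * k) (sym (*-identityˡ (suc D))) D<tk) ⟩
    A 1 * (t * k)     ∎)
    where open ≤-Reasoning

  module Concentrated {N m : ℕ} .{{_ : NonZero N}} (mass : 99 * N ≤ 100 * (A m + A (suc m)))
                      (outside : ∀ j → j ≢ m → j ≢ suc m → 100 * A j ≤ N) where

    pair≰32*outside : ∀ j → j ≢ m → j ≢ suc m → ¬ (A m + A (suc m) ≤ 32 * A j)
    pair≰32*outside j j≢m j≢1+m pair≤ = from-no (99 ≤? 32) (*-cancelʳ-≤ 99 32 N (begin
      99 * N                  ≤⟨ mass ⟩
      100 * (A m + A (suc m)) ≤⟨ *-monoʳ-≤ 100 pair≤ ⟩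
      100 * (32 * A j)        ≡⟨ trans (sym (*-assoc 100 32 (A j))) (*-assoc 32 100 (A j)) ⟩
      32 * (100 * A j)        ≤⟨ *-monoʳ-≤ 32 (outside j j≢m j≢1+m) ⟩
      32 * N                  ∎))
      where open ≤-Reasoning

    ascent-impossible : suc (suc m) ≤ t → suc (suc m) ≤ k → ¬ (A m ≤ A (suc m))
    ascent-impossible 2+m≤t 2+m≤k ascent =
      pair≰32*outside (suc (suc m)) (≢-sym (m≢1+n+m m {1})) 1+n≢n
        (subst (_≤ 32 * A (suc (suc m))) (+-comm (A (suc m)) (A m))
          (v≤u≤16*a⇒u+v≤32*a (A (suc (suc m))) ascent (u*u≤16*[a*v]⇒u≤16*a (A (suc (suc m))) ascent
            (subst (λ x → A (suc m) * A (suc m) ≤ 16 * x) (*-comm (A m) (A (suc (suc m))))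
              (A-square≤16*neighbours m 2+m≤t 2+m≤k)))))

    peak-descends : A (suc m) ≤ A m
    peak-descends with <-both⊎≤-either (suc m) t k
    ... | inj₁ (2+m≤t , 2+m≤k) = ≰⇒≥ (ascent-impossible 2+m≤t 2+m≤k)
    ... | inj₂ past            = A-nonincreasing m past

    peak-at-zero : m ≡ 0
    peak-at-zero = n<1⇒n≡0 (≰⇒> peak-not-after-zero)
      where
      peak-not-after-zero : ¬ (1 ≤ m)
      peak-not-after-zero (s≤s {n = i} z≤n) with <-both⊎≤-either (suc i) t k
      ... | inj₁ (2+i≤t , 2+i≤k) = pair≰32*outside i (m≢1+n+m i {0}) (m≢1+n+m i {1})
        (v≤u≤16*a⇒u+v≤32*a (A i) peak-descends
          (u*u≤16*[a*v]⇒u≤16*a (A i) peak-descends (A-square≤16*neighbours i 2+i≤t 2+i≤k)))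
      ... | inj₂ past            = pair≰32*outside i (m≢1+n+m i {0}) (m≢1+n+m i {1})
        (v≤u≤16*a⇒u+v≤32*a (A i) peak-descends (≤-trans (A-nonincreasing i past) (m≤n*m (A i) 16)))

    N≤3*A0 : N ≤ 3 * A 0
    N≤3*A0 with refl ← peak-at-zero = *-cancelˡ-≤ 99 (begin
      99 * N            ≤⟨ mass ⟩
      100 * (A 0 + A 1) ≤⟨ *-monoʳ-≤ 100 (+-monoʳ-≤ (A 0) peak-descends) ⟩
      100 * (A 0 + A 0) ≡⟨ trans (*-distribˡ-+ 100 (A 0) (A 0)) (sym (*-distribʳ-+ (A 0) 100 100)) ⟩
      200 * A 0         ≤⟨ *-monoˡ-≤ (A 0) (m≤m+n 200 97) ⟩
      297 * A 0         ≡⟨ *-assoc 99 3 (A 0) ⟩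
      99 * (3 * A 0)    ∎)
      where open ≤-Reasoning

    2tk≤3n : 2 * t * k ≤ 3 * (t + (k + D))
    2tk≤3n with refl ← peak-at-zero | <-both⊎≤-either 1 t k
    ... | inj₁ (2≤t , 2≤k) = decidable-stable (2 * t * k ≤? 3 * (t + (k + D)))
                               (ascent-impossible 2≤t 2≤k ∘ A0≤A1 ∘ 2tk≰3n⇒D<tk t k D)
    ... | inj₂ (inj₁ t≤1)  = a≤1⇒2*a*b≤3*n t≤1 (≤-trans (m≤m+n k D) (m≤n+m (k + D) t))
    ... | inj₂ (inj₂ k≤1)  = subst (_≤ 3 * (t + (k + D))) (2*k*t≡2*t*k t k)
                               (a≤1⇒2*a*b≤3*n k≤1 (m≤m+n t (k + D)))
      where 2*k*t≡2*t*k : ∀ t k → 2 * k * t ≡ 2 * t * k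
            2*k*t≡2*t*k = solve-∀

2a≤a+b⇒a≤b : ∀ a {b} → 2 * a ≤ a + b → a ≤ b
2a≤a+b⇒a≤b a {b} 2a≤a+b = +-cancelˡ-≤ a a b (subst (_≤ a + b) (cong (a +_) (+-identityʳ a)) 2a≤a+b)

2a≤n⇒2b≤n⇒a+b≤n : ∀ {a b n} → 2 * a ≤ n → 2 * b ≤ n → a + b ≤ n
2a≤n⇒2b≤n⇒a+b≤n {a} {b} {n} 2a≤n 2b≤n = *-cancelˡ-≤ 2 (begin
  2 * (a + b)   ≡⟨ *-distribˡ-+ 2 a b ⟩
  2 * a + 2 * b ≤⟨ +-mono-≤ 2a≤n 2b≤n ⟩
  n + n         ≡⟨ cong (n +_) (+-identityʳ n) ⟨
  2 * n         ∎)
  where open ≤-Reasoning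

∃[D]t+[k+D]≡n : ∀ {t k n} → 2 * t ≤ n → 2 * k ≤ n → ∃[ D ] t + (k + D) ≡ n
∃[D]t+[k+D]≡n {t} {k} 2t≤n 2k≤n
  with D , t+k+D≡n ← m≤n⇒∃[o]m+o≡n (2a≤n⇒2b≤n⇒a+b≤n {t} {k} 2t≤n 2k≤n) =
  D , trans (sym (+-assoc t k D)) t+k+D≡n

a+s≤N⇒100a≤N : ∀ {a s N} → a + s ≤ N → 99 * N ≤ 100 * s → 100 * a ≤ N
a+s≤N⇒100a≤N {a} {s} {N} a+s≤N 99N≤100s = +-cancelʳ-≤ (99 * N) (100 * a) N (begin
  100 * a + 99 * N  ≤⟨ +-monoʳ-≤ (100 * a) 99N≤100s ⟩
  100 * a + 100 * s ≡⟨ *-distribˡ-+ 100 a s ⟨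
  100 * (a + s)     ≤⟨ *-monoʳ-≤ 100 a+s≤N ⟩
  100 * N           ∎)
  where open ≤-Reasoning

prefixCount-concentration : ∀ n k t m → 2 * k ≤ n → 2 * t ≤ n →
  99 * length (slice n k) ≤ 100 * count (λ x → (prefixSum t x ≡ᵇ m) ∨ (prefixSum t x ≡ᵇ suc m)) (slice n k) →
  (length (slice n k) ≤ 3 * prefixCount n k t 0) × (2 * t * k ≤ 3 * n)
prefixCount-concentration n k t m 2k≤n 2t≤n mass with D , refl ← ∃[D]t+[k+D]≡n {t} {k} 2t≤n 2k≤n =
  N≤3*A0 , 2tk≤3n
  where
  A : ℕ → ℕ
  A = prefixCount (t + (k + D)) k t
  S = slice (t + (k + D)) k
  pair-count : count (λ x → (prefixSum t x ≡ᵇ m) ∨ (prefixSum t x ≡ᵇ suc m)) S ≡ A m + A (suc m)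
  pair-count = count-∨ _ _ (λ x → ≡ᵇ-disjoint (prefixSum t x) (m≢1+n+m m {0})) S
  pair-mass : 99 * length S ≤ 100 * (A m + A (suc m))
  pair-mass = subst (λ s → 99 * length S ≤ 100 * s) pair-count mass
  outside : ∀ j → j ≢ m → j ≢ suc m → 100 * A j ≤ length S
  outside j j≢m j≢1+m = a+s≤N⇒100a≤N {A j} (subst (_≤ length S) j-and-pair (count≤length _ S)) pair-mass
    where
    disjoint : ∀ x → (prefixSum t x ≡ᵇ j) ∧ ((prefixSum t x ≡ᵇ m) ∨ (prefixSum t x ≡ᵇ suc m)) ≡ false
    disjoint x = trans (∧-distribˡ-∨ (prefixSum t x ≡ᵇ j) _ _)
                       (cong₂ _∨_ (≡ᵇ-disjoint (prefixSum t x) j≢m) (≡ᵇ-disjoint (prefixSum t x) j≢1+m))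
    j-and-pair = trans (count-∨ _ _ disjoint S) (cong (A j +_) pair-count)
  instance
    N≢0 : NonZero (length S)
    N≢0 = >-nonZero (subst (1 ≤_) (sym (length-slice _ k)) (nCk>0 (≤-trans (m≤m+n k D) (m≤n+m (k + D) t))))
  k≤t+D : k ≤ t + D
  k≤t+D = 2a≤a+b⇒a≤b k (subst (2 * k ≤_) (x+[y+z]≡y+[x+z] t k D) 2k≤n)
    where x+[y+z]≡y+[x+z] : ∀ x y z → x + (y + z) ≡ y + (x + z)
          x+[y+z]≡y+[x+z] = solve-∀
  open HypergeometricRecurrence A (2a≤a+b⇒a≤b t 2t≤n) k≤t+D (prefixCount-recurrence t k D)
  open Concentrated pair-mass outside

≤ratio⇒*≤* : ∀ p q a {N} → 1 ≤ N → ℤ.+ p / suc q ≤ℚ ratio a N → p * N ≤ suc q * a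
≤ratio⇒*≤* p q a {suc b} _ p/q≤a/N
  with *≤* pb≤aq ← ≤-respʳ-≃ (toℚᵘ-fromℚᵘ (mkℚᵘ (ℤ.+ a) b))
                    (≤-respˡ-≃ (toℚᵘ-fromℚᵘ (mkℚᵘ (ℤ.+ p) q)) (toℚᵘ-mono-≤ p/q≤a/N)) =
  subst (p * suc b ≤_) (*-comm a (suc q))
    (ℤ.drop‿+≤+ (subst₂ ℤ._≤_ (sym (pos-* p (suc b))) (sym (pos-* a (suc q))) pb≤aq))

*≤*⇒≤ratio : ∀ p q a {N} → 1 ≤ N → p * N ≤ suc q * a → ℤ.+ p / suc q ≤ℚ ratio a N
*≤*⇒≤ratio p q a {suc b} _ pN≤qa = toℚᵘ-cancel-≤
  (≤-respʳ-≃ (≃-sym (toℚᵘ-fromℚᵘ (mkℚᵘ (ℤ.+ a) b)))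
    (≤-respˡ-≃ (≃-sym (toℚᵘ-fromℚᵘ (mkℚᵘ (ℤ.+ p) q)))
      (*≤* (subst₂ ℤ._≤_ (pos-* p (suc b)) (pos-* a (suc q))
        (ℤ.+≤+ (subst (p * suc b ≤_) (*-comm (suc q) a) pN≤qa))))))

γ₀ : ℚ
γ₀ = ℤ.+ 1 / 100

c₀ : ℚ
c₀ = ℤ.+ 1 / 3

lemma12 : ∃[ γ₀ ] ∃[ c₀ ] ((0ℚ < γ₀) × (0ℚ < c₀) ×
            ((n k t m : ℕ) → 2 ≤ n → 2 * k ≤ n → 2 * t ≤ n →
              (1ℚ - γ₀) ≤ℚ Pr n k (λ x → (prefixSum t x ≡ᵇ m) ∨ (prefixSum t x ≡ᵇ suc m)) →
              (c₀ ≤ℚ Pr n k (λ x → prefixSum t x ≡ᵇ 0)) × (k ≢ 0 → 2 * t * k ≤ 3 * n)))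
lemma12 = γ₀ , c₀ , *<* (ℤ.+<+ (s≤s z≤n)) , *<* (ℤ.+<+ (s≤s z≤n)) , concentration
  where
  concentration : (n k t m : ℕ) → 2 ≤ n → 2 * k ≤ n → 2 * t ≤ n →
    (1ℚ - γ₀) ≤ℚ Pr n k (λ x → (prefixSum t x ≡ᵇ m) ∨ (prefixSum t x ≡ᵇ suc m)) →
    (c₀ ≤ℚ Pr n k (λ x → prefixSum t x ≡ᵇ 0)) × (k ≢ 0 → 2 * t * k ≤ 3 * n)
  concentration n k t m _ 2k≤n 2t≤n pair-likely =
    *≤*⇒≤ratio 1 2 (A 0) N≥1 (subst (_≤ 3 * A 0) (sym (*-identityˡ N)) N≤3*A0) , const 2tk≤3n
    where
    N = length (slice n k)
    A = prefixCount n k t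
    N≥1 : 1 ≤ N
    N≥1 = subst (1 ≤_) (sym (length-slice n k)) (nCk>0 (≤-trans (m≤n*m k 2) 2k≤n))
    bounds : (N ≤ 3 * A 0) × (2 * t * k ≤ 3 * n)
    bounds = prefixCount-concentration n k t m 2k≤n 2t≤n (≤ratio⇒*≤* 99 99 _ N≥1 pair-likely)
    N≤3*A0 = proj₁ bounds
    2tk≤3n = proj₂ bounds
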